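{- Let $\mathcal{B}$ be a connected building set on a finite set $E$ which is closed under intersection, and for $S\subseteq E$ let $\bar y_S$ be the number of unordered pairs $\{s,t\}$ of elements of $E$ (with $s=t$ allowed) such that $P(s,t)=S$. Then (i) $\bar y_S>0$ for all $S\in\mathcal{P}(\mathcal{B})$ and $\bar y_S=0$ otherwise; (ii) for all $B\in\mathcal{B}$, $\sum_{S\subseteq B}\bar y_S=\binom{|B|+1}{2}$.
   Context: A building set on $E$ is a collection $\mathcal{B}$ of non-empty subsets of $E$ closed under union of intersecting members and containing all singletons; connected means $E\in\mathcal{B}$; closed under intersection means $B\cap B'\in\mathcal{B}\cup\{\varnothing\}$ for all $B,B'\in\mathcal{B}$. For $s,t\in E$ (possibly equal), the $\mathcal{B}$-path $P(s,t)$ is the smallest element of $\mathcal{B}$ containing $\{s,t\}$, and $\mathcal{P}(\mathcal{B})=\{P(s,t):s,t\in E\}$. -}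

module Defs where

open import Data.Bool using (Bool; true; false; T)
open import Data.Nat using (ℕ; zero; suc)
open import Data.Fin using (Fin; _≤_; _≤?_)
open import Data.Fin.Subset using (Subset; _∈_; _⊆_; _∪_; _∩_; ⁅_⁆; ⊤; Nonempty)
open import Data.Fin.Subset.Properties using (_∈?_; _⊆?_)
open import Data.List using (List; []; _∷_; _++_; map; filter; length; concatMap)
open import Data.Nat.ListAction using (sum)
open import Data.List.Membership.Propositional using () renaming (_∈_ to _∈ₗ_)
open import Data.List.Membership.Propositional.Properties using (∈-++⁺ˡ; ∈-++⁺ʳ; ∈-map⁺)
open import Data.List.Relation.Unary.All using (All; lookup; all?; tabulate)
open import Data.List.Relation.Unary.Any using (here)
open import Data.List using () renaming (allFin to finList)
open import Data.Product using (Σ; ∃; ∃-syntax; _×_; _,_; proj₁; proj₂)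
open import Data.Vec using ([]; _∷_)
open import Relation.Nullary using (Dec; yes; no; ¬_)
open import Relation.Nullary.Decidable using (_×-dec_; _→-dec_)
open import Relation.Binary.PropositionalEquality using (_≡_; refl)

-- The ground set is E = Fin n; subsets of E are `Subset n`.
-- A collection 𝓑 of subsets of E is given by its (Boolean)
-- characteristic function; S ∈ 𝓑 means T (𝓑 S).

Collection : ℕ → Set
Collection n = Subset n → Bool

_∈𝓑_ : ∀ {n} → Subset n → Collection n → Set
S ∈𝓑 𝓑 = T (𝓑 S)

record IsBuildingSet {n : ℕ} (𝓑 : Collection n) : Set where
  field
    nonempty   : ∀ S → S ∈𝓑 𝓑 → Nonempty S
    singletons : ∀ (i : Fin n) → ⁅ i ⁆ ∈𝓑 𝓑
    ∪-closed   : ∀ S S′ → S ∈𝓑 𝓑 → S′ ∈𝓑 𝓑 → Nonempty (S ∩ S′) → (S ∪ S′) ∈𝓑 𝓑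

Connected : ∀ {n} → Collection n → Set
Connected 𝓑 = ⊤ ∈𝓑 𝓑

-- Closed under intersection: B ∩ B′ ∈ 𝓑 ∪ {∅}, i.e. it is in 𝓑 whenever
-- it is non-empty.
ClosedUnderIntersection : ∀ {n} → Collection n → Set
ClosedUnderIntersection 𝓑 =
  ∀ S S′ → S ∈𝓑 𝓑 → S′ ∈𝓑 𝓑 → Nonempty (S ∩ S′) → (S ∩ S′) ∈𝓑 𝓑

-- `IsPath 𝓑 s t S` : S is the smallest element of 𝓑 containing {s,t},
-- i.e. S = P(s,t).
IsPath : ∀ {n} → Collection n → Fin n → Fin n → Subset n → Set
IsPath 𝓑 s t S =
  S ∈𝓑 𝓑 × s ∈ S × t ∈ S ×
  (∀ B′ → B′ ∈𝓑 𝓑 → s ∈ B′ → t ∈ B′ → S ⊆ B′)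

_∈𝒫_ : ∀ {n} → Subset n → Collection n → Set
S ∈𝒫 𝓑 = ∃[ s ] ∃[ t ] IsPath 𝓑 s t S

allSubsets : ∀ n → List (Subset n)
allSubsets zero    = [] ∷ []
allSubsets (suc n) = map (true ∷_) (allSubsets n) ++ map (false ∷_) (allSubsets n)

allSubsets-complete : ∀ {n} (S : Subset n) → S ∈ₗ allSubsets n
allSubsets-complete []          = here refl
allSubsets-complete (true ∷ S)  = ∈-++⁺ˡ (∈-map⁺ (true ∷_) (allSubsets-complete S))
allSubsets-complete {suc n} (false ∷ S) =
  ∈-++⁺ʳ (map (true ∷_) (allSubsets n)) (∈-map⁺ (false ∷_) (allSubsets-complete S))

private
  T? : ∀ b → Dec (T b)
  T? true  = yes _
  T? false = no (λ ())

  minimal? : ∀ {n} (𝓑 : Collection n) s t S →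
             Dec (∀ B′ → B′ ∈𝓑 𝓑 → s ∈ B′ → t ∈ B′ → S ⊆ B′)
  minimal? {n} 𝓑 s t S
    with all? (λ B′ → T? (𝓑 B′) →-dec ((s ∈? B′) →-dec ((t ∈? B′) →-dec (S ⊆? B′))))
              (allSubsets n)
  ... | yes p = yes (λ B′ → lookup p (allSubsets-complete B′))
  ... | no ¬p = no (λ f → ¬p (tabulate (λ {B′} _ → f B′)))

isPath? : ∀ {n} (𝓑 : Collection n) s t S → Dec (IsPath 𝓑 s t S)
isPath? 𝓑 s t S = T? (𝓑 S) ×-dec (s ∈? S) ×-dec (t ∈? S) ×-dec minimal? 𝓑 s t S

-- Unordered pairs {s,t} with s = t allowed, encoded as (s , t) with s ≤ t.
unorderedPairs : ∀ n → List (Fin n × Fin n)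
unorderedPairs n =
  filter (λ p → proj₁ p ≤? proj₂ p)
         (concatMap (λ s → map (s ,_) (finList n)) (finList n))

ȳ : ∀ {n} → Collection n → Subset n → ℕ
ȳ 𝓑 S = length (filter (λ p → isPath? 𝓑 (proj₁ p) (proj₂ p) S) (unorderedPairs _))

sumBelow : ∀ {n} → Collection n → Subset n → ℕ
sumBelow {n} 𝓑 B = sum (map (ȳ 𝓑) (filter (_⊆? B) (allSubsets n)))

-- Every pair s, t has a 𝓑-path: the intersection of all members of 𝓑 containing
-- s and t lies in 𝓑 (the empty intersection is E, which is in 𝓑 by connectedness;
-- the others by closure under intersection), and it is the least such member. For part (ii), exchange the
-- order of summation: ∑_{S ⊆ B} ȳ_S counts pairs {s,t} together with a subset
-- S ⊆ B equal to P(s,t). For B ∈ 𝓑 there is exactly one such S when s, t ∈ B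
-- (namely P(s,t) ⊆ B) and none otherwise, so the sum counts the unordered pairs
-- in B, of which there are C(|B| + 1, 2).

module Submission where

open import Defs
open import Data.Nat using (ℕ; _<_; _+_)
open import Data.Nat.Combinatorics using (_C_)
open import Data.Fin.Subset using (Subset; ∣_∣)
open import Data.Product using (_×_)
open import Relation.Nullary using (¬_)
open import Relation.Binary.PropositionalEquality using (_≡_)

open import Algebra.Properties.CommutativeSemigroup using (interchange)
open import Data.Bool using (true; false; _∧_; if_then_else_)
open import Data.Bool.Properties using (T?)
open import Data.Fin using (Fin; _≤_; _≤?_) renaming (zero to fz; suc to fs)
import Data.Fin.Properties as Fin
open import Data.Fin.Subset using (_∈_; _⊆_; ⋂)
open import Data.Fin.Subset.Properties using (_∈?_; _⊆?_; ∈⊤; ⊆-antisym; p∩q⊆p; p∩q⊆q; x∈p∩q⁺)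
open import Data.List using (List; []; _∷_; _++_; map; filter; length; concatMap; tabulate)
open import Data.List using () renaming (allFin to finList)
open import Data.List.Membership.Propositional using (lose) renaming (_∈_ to _∈ₗ_)
open import Data.List.Membership.Propositional.Properties
  using (∈-filter⁺; ∈-filter⁻; ∈-map⁻; ∈-map⁺; ∈-concatMap⁺; ∈-allFin)
open import Data.List.Properties
  using (filter-accept; filter-reject; filter-none; filter-some; map-++;
         map-cong; map-∘; map-tabulate; tabulate-cong)
open import Data.List.Relation.Binary.Disjoint.Propositional using (Disjoint)
open import Data.List.Relation.Unary.All as All using (All; []; _∷_)
open import Data.List.Relation.Unary.All.Properties using (all-filter)
import Data.List.Relation.Unary.AllPairs as AllPairs
open import Data.List.Relation.Unary.Any using (here; there)
open import Data.List.Relation.Unary.Unique.Propositional using (Unique)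
import Data.List.Relation.Unary.Unique.Propositional.Properties as Unique
open import Data.Nat using (zero; suc; s≤s; s≤s⁻¹)
open import Data.Nat.Combinatorics using (nC1≡n; nCk+nC[k+1]≡[n+1]C[k+1])
open import Data.Nat.ListAction using (sum)
open import Data.Nat.ListAction.Properties using (sum-++)
open import Data.Nat.Properties using (+-comm; +-commutativeSemigroup)
open import Data.Product using (_,_; proj₁; proj₂)
open import Data.Sum using (inj₁; inj₂)
open import Data.Vec using ([]) renaming (_∷_ to _∷ᵥ_)
open import Data.Vec.Properties using (∷-injectiveʳ)
open import Function using (_∘_; mk⇔)
open import Level using (Level)
open import Relation.Nullary using (Dec; yes; no; does)
open import Relation.Nullary.Decidable using (_×-dec_; does-⇔)
open import Relation.Unary using (Pred; Decidable)
open import Relation.Binary.PropositionalEquality using (refl; sym; trans; cong; cong₂; module ≡-Reasoning)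

private variable
  p : Level
  A B : Set

χ : {P : Set p} → Dec P → ℕ
χ P? = if does P? then 1 else 0

module _ {P : Pred A p} (P? : Decidable P) where

  length-filter≡sum-χ : ∀ xs → length (filter P? xs) ≡ sum (map (χ ∘ P?) xs)
  length-filter≡sum-χ []       = refl
  length-filter≡sum-χ (x ∷ xs) with P? x
  ... | yes _ = cong suc (length-filter≡sum-χ xs)
  ... | no  _ = length-filter≡sum-χ xs

  length-filter∘filter≡sum-χ : ∀ {q} {Q : Pred A q} (Q? : Decidable Q) xs →
    length (filter Q? (filter P? xs)) ≡ sum (map (λ x → χ (P? x ×-dec Q? x)) xs)
  length-filter∘filter≡sum-χ Q? []       = refl
  length-filter∘filter≡sum-χ Q? (x ∷ xs) with P? x
  ... | no  _ = length-filter∘filter≡sum-χ Q? xs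
  ... | yes _ with Q? x
  ...   | yes _ = cong suc (length-filter∘filter≡sum-χ Q? xs)
  ...   | no  _ = length-filter∘filter≡sum-χ Q? xs

  Unique⇒filter≡[x] : ∀ {x xs} → Unique xs → x ∈ₗ xs → P x → (∀ {y} → P y → y ≡ x) →
                      filter P? xs ≡ x ∷ []
  Unique⇒filter≡[x] (y≢ys AllPairs.∷ _) (here refl) Px only-x =
    trans (filter-accept P? Px) (cong (_ ∷_) (filter-none P? (All.map (λ y≢z Pz → y≢z (sym (only-x Pz))) y≢ys)))
  Unique⇒filter≡[x] (y≢ys AllPairs.∷ ys-unique) (there x∈ys) Px only-x =
    trans (filter-reject P? (λ Py → All.lookup y≢ys x∈ys (only-x Py)))
          (Unique⇒filter≡[x] ys-unique x∈ys Px only-x)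

sum-map-zero : ∀ (xs : List A) → sum (map (λ _ → 0) xs) ≡ 0
sum-map-zero []       = refl
sum-map-zero (_ ∷ xs) = sum-map-zero xs

sum-map-+ : ∀ (f g : A → ℕ) xs → sum (map (λ x → f x + g x) xs) ≡ sum (map f xs) + sum (map g xs)
sum-map-+ f g []       = refl
sum-map-+ f g (x ∷ xs) = trans (cong (f x + g x +_) (sum-map-+ f g xs))
                               (interchange +-commutativeSemigroup (f x) (g x) _ _)

sum-map-swap : ∀ (f : A → B → ℕ) as bs →
  sum (map (λ a → sum (map (f a) bs)) as) ≡ sum (map (λ b → sum (map (λ a → f a b) as)) bs)
sum-map-swap f []       bs = sym (sum-map-zero bs)
sum-map-swap f (a ∷ as) bs = trans (cong (sum (map (f a) bs) +_) (sum-map-swap f as bs))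
                                   (sym (sum-map-+ (f a) _ bs))

sum-map-concatMap : ∀ (f : B → ℕ) (g : A → List B) xs →
  sum (map f (concatMap g xs)) ≡ sum (map (λ x → sum (map f (g x))) xs)
sum-map-concatMap f g []       = refl
sum-map-concatMap f g (x ∷ xs) = begin
  sum (map f (g x ++ concatMap g xs))                ≡⟨ cong sum (map-++ f (g x) _) ⟩
  sum (map f (g x) ++ map f (concatMap g xs))        ≡⟨ sum-++ (map f (g x)) _ ⟩
  sum (map f (g x)) + sum (map f (concatMap g xs))   ≡⟨ cong (sum (map f (g x)) +_) (sum-map-concatMap f g xs) ⟩
  sum (map (λ x → sum (map f (g x))) (x ∷ xs))       ∎
  where open ≡-Reasoning

sum-tabulate-zero : ∀ n → sum (tabulate {n = n} λ _ → 0) ≡ 0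
sum-tabulate-zero zero    = refl
sum-tabulate-zero (suc n) = sum-tabulate-zero n

allSubsets-unique : ∀ n → Unique (allSubsets n)
allSubsets-unique zero    = [] AllPairs.∷ AllPairs.[]
allSubsets-unique (suc n) =
  Unique.++⁺ (Unique.map⁺ ∷-injectiveʳ (allSubsets-unique n))
             (Unique.map⁺ ∷-injectiveʳ (allSubsets-unique n))
             heads-differ
  where
  heads-differ : Disjoint (map (true ∷ᵥ_) (allSubsets n)) (map (false ∷ᵥ_) (allSubsets n))
  heads-differ (S∈true , S∈false) with ∈-map⁻ (true ∷ᵥ_) S∈true | ∈-map⁻ (false ∷ᵥ_) S∈false
  ... | _ , _ , refl | _ , _ , ()

module _ {n : ℕ} where

  ∈-⋂ : ∀ {x : Fin n} {Bs} → All (x ∈_) Bs → x ∈ ⋂ Bs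
  ∈-⋂ []             = ∈⊤
  ∈-⋂ (x∈B ∷ x∈⋂Bs) = x∈p∩q⁺ (x∈B , ∈-⋂ x∈⋂Bs)

  ⋂-⊆ : ∀ {B : Subset n} {Bs} → B ∈ₗ Bs → ⋂ Bs ⊆ B
  ⋂-⊆ {Bs = B ∷ Bs} (here refl) = p∩q⊆p B (⋂ Bs)
  ⋂-⊆ {Bs = B ∷ Bs} (there B∈Bs) = ⋂-⊆ B∈Bs ∘ p∩q⊆q B (⋂ Bs)

sum-tabulate-χ∈≡∣∣ : ∀ {n} (B : Subset n) → sum (tabulate λ t → χ (t ∈? B)) ≡ ∣ B ∣
sum-tabulate-χ∈≡∣∣ []           = refl
sum-tabulate-χ∈≡∣∣ (true ∷ᵥ B)  = cong suc (sum-tabulate-χ∈≡∣∣ B)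
sum-tabulate-χ∈≡∣∣ (false ∷ᵥ B) = sum-tabulate-χ∈≡∣∣ B

#≤pairsIn : ∀ {n} → Subset n → ℕ
#≤pairsIn B = sum (tabulate λ s → sum (tabulate λ t → χ (s ≤? t ×-dec (s ∈? B ×-dec t ∈? B))))

#≤pairsIn-∷ : ∀ {n} b (B : Subset n) → #≤pairsIn (b ∷ᵥ B) ≡ (if b then suc ∣ B ∣ else 0) + #≤pairsIn B
-- does (fs s ≤? fs t) and does (s ≤? t) agree but are not definitionally equal.
#≤pairsIn-∷ {n} b B = cong₂ _+_ (first-row b) (cong sum (tabulate-cong {n = n} λ s →
  cong sum (tabulate-cong {n = n} λ t → cong (λ s≤t → if s≤t ∧ (does (s ∈? B) ∧ does (t ∈? B)) then 1 else 0)
                                             (does-⇔ (mk⇔ s≤s⁻¹ s≤s) (fs s ≤? fs t) (s ≤? t)))))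
  where
  first-row : ∀ b → sum (tabulate λ t → χ (fz {n} ≤? t ×-dec (fz ∈? b ∷ᵥ B ×-dec t ∈? b ∷ᵥ B)))
                  ≡ (if b then suc ∣ B ∣ else 0)
  first-row true  = sum-tabulate-χ∈≡∣∣ (true ∷ᵥ B)
  first-row false = sum-tabulate-zero (suc n)

#≤pairsIn≡C : ∀ {n} (B : Subset n) → #≤pairsIn B ≡ (∣ B ∣ + 1) C 2
#≤pairsIn≡C []           = refl
#≤pairsIn≡C (false ∷ᵥ B) = trans (#≤pairsIn-∷ false B) (#≤pairsIn≡C B)
#≤pairsIn≡C (true ∷ᵥ B)  = begin
  #≤pairsIn (true ∷ᵥ B)              ≡⟨ #≤pairsIn-∷ true B ⟩
  suc ∣ B ∣ + #≤pairsIn B            ≡⟨ cong (suc ∣ B ∣ +_) (#≤pairsIn≡C B) ⟩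
  suc ∣ B ∣ + (∣ B ∣ + 1) C 2        ≡⟨ cong (_+ (∣ B ∣ + 1) C 2) (trans (+-comm 1 ∣ B ∣) (sym (nC1≡n (∣ B ∣ + 1)))) ⟩
  (∣ B ∣ + 1) C 1 + (∣ B ∣ + 1) C 2  ≡⟨ nCk+nC[k+1]≡[n+1]C[k+1] (∣ B ∣ + 1) 1 ⟩
  (suc ∣ B ∣ + 1) C 2                ∎
  where open ≡-Reasoning

∈-unorderedPairs : ∀ {n} {s t : Fin n} → s ≤ t → (s , t) ∈ₗ unorderedPairs n
∈-unorderedPairs {n} {s} {t} = ∈-filter⁺ (λ p → proj₁ p ≤? proj₂ p)
  (∈-concatMap⁺ (λ s → map (s ,_) (finList n)) (lose (∈-allFin s) (∈-map⁺ (s ,_) (∈-allFin t))))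

bothIn? : ∀ {n} (B : Subset n) → Decidable (λ (p : Fin n × Fin n) → proj₁ p ∈ B × proj₂ p ∈ B)
bothIn? B (s , t) = s ∈? B ×-dec t ∈? B

#unorderedPairsIn≡#≤pairsIn : ∀ {n} (B : Subset n) → length (filter (bothIn? B) (unorderedPairs n)) ≡ #≤pairsIn B
#unorderedPairsIn≡#≤pairsIn {n} B = begin
  length (filter (bothIn? B) (filter ≤?-pair allPairs))
    ≡⟨ length-filter∘filter≡sum-χ ≤?-pair (bothIn? B) allPairs ⟩
  sum (map f allPairs)
    ≡⟨ sum-map-concatMap f (λ s → map (s ,_) (finList n)) (finList n) ⟩
  sum (map (λ s → sum (map f (map (s ,_) (finList n)))) (finList n))
    ≡⟨ cong sum (map-cong (λ s → cong sum (sym (map-∘ (finList n)))) (finList n)) ⟩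
  sum (map (λ s → sum (map (λ t → f (s , t)) (finList n))) (finList n))
    ≡⟨ cong sum (map-cong (λ s → cong sum (map-tabulate (λ t → t) (λ t → f (s , t)))) (finList n)) ⟩
  sum (map (λ s → sum (tabulate (λ t → f (s , t)))) (finList n))
    ≡⟨ cong sum (map-tabulate {n = n} (λ s → s) (λ s → sum (tabulate (λ t → f (s , t))))) ⟩
  #≤pairsIn B ∎
  where
  open ≡-Reasoning
  allPairs : List (Fin n × Fin n)
  allPairs = concatMap (λ s → map (s ,_) (finList n)) (finList n)
  ≤?-pair : Decidable (λ (p : Fin n × Fin n) → proj₁ p ≤ proj₂ p)
  ≤?-pair (s , t) = s ≤? t
  f : Fin n × Fin n → ℕ
  f p = χ (≤?-pair p ×-dec bothIn? B p)

module _ {n : ℕ} (𝓑 : Collection n) where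

  IsPath-sym : ∀ {s t S} → IsPath 𝓑 s t S → IsPath 𝓑 t s S
  IsPath-sym (S∈𝓑 , s∈S , t∈S , least) = S∈𝓑 , t∈S , s∈S , λ B′ B′∈𝓑 t∈B′ s∈B′ → least B′ B′∈𝓑 s∈B′ t∈B′

  IsPath-unique : ∀ {s t S S′} → IsPath 𝓑 s t S → IsPath 𝓑 s t S′ → S ≡ S′
  IsPath-unique (S∈𝓑 , s∈S , t∈S , S-least) (S′∈𝓑 , s∈S′ , t∈S′ , S′-least) =
    ⊆-antisym (S-least _ S′∈𝓑 s∈S′ t∈S′) (S′-least _ S∈𝓑 s∈S t∈S)

  filter-isPath-⊈ : ∀ {B s t} → ¬ (s ∈ B × t ∈ B) →
    filter (isPath? 𝓑 s t) (filter (_⊆? B) (allSubsets n)) ≡ []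
  filter-isPath-⊈ {B} {s} {t} s,t∉B = filter-none (isPath? 𝓑 s t) {filter (_⊆? B) (allSubsets n)}
    (All.tabulate λ S∈below (_ , s∈S , t∈S , _) →
      let S⊆B = proj₂ (∈-filter⁻ (_⊆? B) {xs = allSubsets n} S∈below) in s,t∉B (S⊆B s∈S , S⊆B t∈S))

  ȳ-pos : ∀ {S} → S ∈𝒫 𝓑 → 0 < ȳ 𝓑 S
  ȳ-pos (s , t , st-path) with Fin.≤-total s t
  ... | inj₁ s≤t = filter-some _ (lose (∈-unorderedPairs s≤t) st-path)
  ... | inj₂ t≤s = filter-some _ (lose (∈-unorderedPairs t≤s) (IsPath-sym st-path))

  ȳ-zero : ∀ {S} → ¬ S ∈𝒫 𝓑 → ȳ 𝓑 S ≡ 0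
  ȳ-zero {S} S∉𝒫 = cong length (filter-none (λ p → isPath? 𝓑 (proj₁ p) (proj₂ p) S) {unorderedPairs n}
    (All.tabulate (λ {(s , t)} _ st-path → S∉𝒫 (s , t , st-path))))

  contains? : ∀ s t → Decidable (λ B → B ∈𝓑 𝓑 × s ∈ B × t ∈ B)
  contains? s t B = T? (𝓑 B) ×-dec s ∈? B ×-dec t ∈? B

  path : Fin n → Fin n → Subset n
  path s t = ⋂ (filter (contains? s t) (allSubsets n))

  module _ (connected : Connected 𝓑) (∩-closed : ClosedUnderIntersection 𝓑) where

    ⋂-∈𝓑 : ∀ {x Bs} → All (λ B → B ∈𝓑 𝓑 × x ∈ B) Bs → ⋂ Bs ∈𝓑 𝓑
    ⋂-∈𝓑 [] = connected
    ⋂-∈𝓑 {x} {B ∷ Bs} ((B∈𝓑 , x∈B) ∷ rest) =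
      ∩-closed B (⋂ Bs) B∈𝓑 (⋂-∈𝓑 rest) (x , x∈p∩q⁺ (x∈B , ∈-⋂ (All.map proj₂ rest)))

    path-isPath : ∀ s t → IsPath 𝓑 s t (path s t)
    path-isPath s t =
        ⋂-∈𝓑 (All.map (λ (B∈𝓑 , s∈B , _) → B∈𝓑 , s∈B) through)
      , ∈-⋂ (All.map (proj₁ ∘ proj₂) through)
      , ∈-⋂ (All.map (proj₂ ∘ proj₂) through)
      , λ B′ B′∈𝓑 s∈B′ t∈B′ → ⋂-⊆ (∈-filter⁺ (contains? s t) (allSubsets-complete B′) (B′∈𝓑 , s∈B′ , t∈B′))
      where
      through : All (λ B → B ∈𝓑 𝓑 × s ∈ B × t ∈ B) (filter (contains? s t) (allSubsets n))
      through = all-filter (contains? s t) (allSubsets n)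

    filter-isPath-below : ∀ {B s t} → B ∈𝓑 𝓑 → s ∈ B → t ∈ B →
      filter (isPath? 𝓑 s t) (filter (_⊆? B) (allSubsets n)) ≡ path s t ∷ []
    filter-isPath-below {B} {s} {t} B∈𝓑 s∈B t∈B =
      Unique⇒filter≡[x] (isPath? 𝓑 s t)
        (Unique.filter⁺ (_⊆? B) (allSubsets-unique n))
        (∈-filter⁺ (_⊆? B) (allSubsets-complete _) (path-least B B∈𝓑 s∈B t∈B))
        st-path (λ S-path → IsPath-unique S-path st-path)
      where
      st-path : IsPath 𝓑 s t (path s t)
      st-path = path-isPath s t
      path-least : ∀ B′ → B′ ∈𝓑 𝓑 → s ∈ B′ → t ∈ B′ → path s t ⊆ B′
      path-least = proj₂ (proj₂ (proj₂ st-path))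

    #paths-below : ∀ {B} → B ∈𝓑 𝓑 → ∀ s t →
      length (filter (isPath? 𝓑 s t) (filter (_⊆? B) (allSubsets n))) ≡ χ (s ∈? B ×-dec t ∈? B)
    #paths-below {B} B∈𝓑 s t with s ∈? B | t ∈? B
    ... | yes s∈B | yes t∈B = cong length (filter-isPath-below B∈𝓑 s∈B t∈B)
    ... | yes _   | no  t∉B = cong length (filter-isPath-⊈ (t∉B ∘ proj₂))
    ... | no  s∉B | _       = cong length (filter-isPath-⊈ (s∉B ∘ proj₁))

    sumBelow≡#unorderedPairsIn : ∀ {B} → B ∈𝓑 𝓑 →
      sumBelow 𝓑 B ≡ length (filter (bothIn? B) (unorderedPairs n))
    sumBelow≡#unorderedPairsIn {B} B∈𝓑 = begin
      sum (map (ȳ 𝓑) below)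
        ≡⟨ cong sum (map-cong (λ S → length-filter≡sum-χ (isPathTo S) pairs) below) ⟩
      sum (map (λ S → sum (map (λ p → χ (isPathTo S p)) pairs)) below)
        ≡⟨ sum-map-swap (λ S p → χ (isPathTo S p)) below pairs ⟩
      sum (map (λ p → sum (map (λ S → χ (isPathTo S p)) below)) pairs)
        ≡⟨ cong sum (map-cong (λ (s , t) → trans (sym (length-filter≡sum-χ (isPath? 𝓑 s t) below))
                                                  (#paths-below B∈𝓑 s t)) pairs) ⟩
      sum (map (χ ∘ bothIn? B) pairs)
        ≡⟨ length-filter≡sum-χ (bothIn? B) pairs ⟨
      length (filter (bothIn? B) pairs) ∎
      where
      open ≡-Reasoning
      below : List (Subset n)
      below = filter (_⊆? B) (allSubsets n)
      pairs : List (Fin n × Fin n)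
      pairs = unorderedPairs n
      isPathTo : ∀ S → Decidable (λ (p : Fin n × Fin n) → IsPath 𝓑 (proj₁ p) (proj₂ p) S)
      isPathTo S (s , t) = isPath? 𝓑 s t S

lemma4p7 : ∀ (n : ℕ) (𝓑 : Collection n) → IsBuildingSet 𝓑 → Connected 𝓑 →
    ClosedUnderIntersection 𝓑 →
    (∀ (S : Subset n) → (S ∈𝒫 𝓑 → 0 < ȳ 𝓑 S) × (¬ (S ∈𝒫 𝓑) → ȳ 𝓑 S ≡ 0))
    × (∀ (B : Subset n) → B ∈𝓑 𝓑 → sumBelow 𝓑 B ≡ (∣ B ∣ + 1) C 2)
lemma4p7 n 𝓑 _ connected ∩-closed =
    (λ S → ȳ-pos 𝓑 , ȳ-zero 𝓑)
  , λ B B∈𝓑 → begin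
      sumBelow 𝓑 B                                   ≡⟨ sumBelow≡#unorderedPairsIn 𝓑 connected ∩-closed B∈𝓑 ⟩
      length (filter (bothIn? B) (unorderedPairs n))  ≡⟨ #unorderedPairsIn≡#≤pairsIn B ⟩
      #≤pairsIn B                                     ≡⟨ #≤pairsIn≡C B ⟩
      (∣ B ∣ + 1) C 2                                 ∎
  where open ≡-Reasoning
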